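{- Let $f_m(k,\ell)$ denote the number of $e\in\mathbf{I}_m(0012)$ with $\textsc{srpt}(e)=k$ and $\textsc{last}(e)=\ell$. For $n\ge 2$ and $0\le k\le n-2$, $f_n(k,k)=f_{n-k}(0,0)$.
   Context: An inversion sequence of length $m$ is a sequence $e=e_1\cdots e_m$ of integers with $0\le e_i\le i-1$. The reduction of a word replaces each occurrence of the $k$-th smallest distinct entry by $k-1$; $e$ contains a pattern $p$ if some subsequence (entries at increasing positions) has reduction $p$, and avoids $p$ otherwise. $\mathbf{I}_m(0012)$ is the set of inversion sequences of length $m$ avoiding $0012$. For $e\in\mathbf{I}_m(0012)$, $\mathcal{R}(e)$ is the set of values appearing at least twice in $e$, $\textsc{srpt}(e)=\min\mathcal{R}(e)$ with the convention $\textsc{srpt}(01\cdots(m-1))=m-1$, and $\textsc{last}(e)=e_m$. -}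

module Defs where

open import Data.Nat using (ℕ; zero; suc; _∸_; _⊓_; _≡ᵇ_; _<ᵇ_; _≤ᵇ_)
open import Data.Nat.Properties using (_≟_)
open import Data.Bool using (Bool; true; false; not; _∧_)
open import Data.List using (List; []; _∷_; _++_; [_]; map; concatMap; filter; length;
  upTo; deduplicate; filterᵇ; foldr)
open import Data.Bool.ListAction using (any)

-- Inversion sequences are lists e = e_1 ... e_m of naturals (0-based position i holds
-- a value ≤ i, i.e. 0 ≤ e_{i+1} ≤ i).
-- invSeqs m enumerates all inversion sequences of length m (each exactly once).
invSeqs : ℕ → List (List ℕ)
invSeqs zero = [ [] ]
invSeqs (suc m) = concatMap (λ e → map (λ v → e ++ [ v ]) (upTo (suc m))) (invSeqs m)

subseqs : List ℕ → List (List ℕ)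
subseqs [] = [ [] ]
subseqs (x ∷ xs) = map (x ∷_) (subseqs xs) ++ subseqs xs

reduction : List ℕ → List ℕ
reduction w = map (λ x → length (deduplicate _≟_ (filterᵇ (_<ᵇ x) w))) w

listEqᵇ : List ℕ → List ℕ → Bool
listEqᵇ [] [] = true
listEqᵇ [] (_ ∷ _) = false
listEqᵇ (_ ∷ _) [] = false
listEqᵇ (x ∷ xs) (y ∷ ys) = (x ≡ᵇ y) ∧ listEqᵇ xs ys

containsᵇ : List ℕ → List ℕ → Bool
containsᵇ p e = any (λ s → listEqᵇ (reduction s) p) (subseqs e)

avoidsᵇ : List ℕ → List ℕ → Bool
avoidsᵇ p e = not (containsᵇ p e)

pat0012 : List ℕ
pat0012 = 0 ∷ 0 ∷ 1 ∷ 2 ∷ []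

occ : ℕ → List ℕ → ℕ
occ v e = length (filterᵇ (v ≡ᵇ_) e)

-- R(e): values appearing at least twice in e (values of a length-m inversion
-- sequence lie in 0..m-1, listed here in increasing order).
repeated : ℕ → List ℕ → List ℕ
repeated m e = filterᵇ (λ v → 2 ≤ᵇ occ v e) (upTo m)

-- srpt(e) = min R(e), with srpt = m-1 when R(e) is empty (e = 01...(m-1)).
srpt : ℕ → List ℕ → ℕ
srpt m e with repeated m e
... | [] = m ∸ 1
... | (r ∷ rs) = foldr _⊓_ r rs

-- last(e) = e_m (default 0 for the empty sequence; never used for m ≥ 1).
lastEntry : List ℕ → ℕ
lastEntry [] = 0
lastEntry (x ∷ []) = x
lastEntry (_ ∷ y ∷ ys) = lastEntry (y ∷ ys)

f : ℕ → ℕ → ℕ → ℕ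
f m k ℓ = length (filterᵇ (λ e → avoidsᵇ pat0012 e ∧ (srpt m e ≡ᵇ k) ∧ (lastEntry e ≡ᵇ ℓ)) (invSeqs m))

-- An inversion sequence of length m + 1 starts with 0.  When that 0 is not repeated, deleting it
-- and lowering the other entries by one is a bijection onto I_m, whose inverse is `shift`.  It
-- preserves containment of any pattern beginning with 00 (the lone 0 cannot serve as a repeated
-- 0) and lowers srpt and last by one; when 0 is repeated, srpt = 0.  So for k ≥ 1 only sequences
-- of the first kind count towards f_{n+1}(k, ℓ), giving f_{n+1}(k+1, ℓ+1) = f_n(k, ℓ), and the
-- theorem follows by applying this k times.
module Submission where

open import Defs
open import Data.Nat using (ℕ; _≤_; _∸_)
open import Relation.Binary.PropositionalEquality using (_≡_)

open import Level using (Level)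
open import Function using (id; _∘_; Injective)
open import Data.Bool using (Bool; true; false; not; _∧_; _∨_; T; T?)
open import Data.Unit using (tt)
open import Data.Bool.Properties using (∧-zeroʳ; ∨-assoc; not-injective)
open import Data.Bool.ListAction using (any; or)
open import Data.Nat using (zero; suc; 2+; _+_; _⊓_; _≡ᵇ_; _<ᵇ_; _≤ᵇ_; s≤s; z≤n)
open import Data.Nat.Properties using (_≟_; suc-injective; ⊓-zeroʳ; +-comm)
open import Data.Product using (_,_)
open import Data.List using (List; []; _∷_; _++_; [_]; map; concatMap; filter; filterᵇ;
  length; upTo; applyUpTo; deduplicate; foldr)
open import Data.List.Properties
  using (map-∘; map-cong; map-++; map-upTo; length-map; length-++; filter-++; filter-≐;
         filter-reject; filter-accept; concatMap-map; concatMap-cong; map-concatMap)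
open import Data.List.Relation.Unary.All as All using (All; []; _∷_)
open import Data.List.Relation.Unary.All.Properties using (concat⁺; map⁺; applyUpTo⁺₂)
open import Relation.Nullary using (does; ¬_; ¬?)
open import Relation.Unary using (Pred; Decidable; _≐_)
open import Relation.Binary.Definitions using (DecidableEquality)
open import Relation.Binary.PropositionalEquality
  using (refl; sym; trans; cong; cong₂; subst; _≗_; module ≡-Reasoning)

private
  variable
    a b p : Level
    A : Set a
    B : Set b

filter-map : {P : Pred B p} (P? : Decidable P) (g : A → B) →
             filter P? ∘ map g ≗ map g ∘ filter (P? ∘ g)
filter-map P? g [] = refl
filter-map P? g (x ∷ xs) with does (P? (g x))
... | true  = cong (g x ∷_) (filter-map P? g xs)
... | false = filter-map P? g xs

filterᵇ-concatMap : (q : B → Bool) (g : A → List B) →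
                    filterᵇ q ∘ concatMap g ≗ concatMap (filterᵇ q ∘ g)
filterᵇ-concatMap q g [] = refl
filterᵇ-concatMap q g (x ∷ xs) =
  trans (filter-++ (T? ∘ q) (g x) (concatMap g xs))
        (cong (filterᵇ q (g x) ++_) (filterᵇ-concatMap q g xs))

filterᵇ-all : (q : A → Bool) → (∀ x → q x ≡ true) → filterᵇ q ≗ id
filterᵇ-all q q≡true [] = refl
filterᵇ-all q q≡true (x ∷ xs) with q x | q≡true x
... | true | refl = cong (x ∷_) (filterᵇ-all q q≡true xs)

filterᵇ-none : (q : A → Bool) → (∀ x → q x ≡ false) → ∀ xs → filterᵇ q xs ≡ []
filterᵇ-none q q≡false [] = refl
filterᵇ-none q q≡false (x ∷ xs) with q x | q≡false x
... | false | refl = filterᵇ-none q q≡false xs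

filterᵇ-cong-All : {q r : A → Bool} {xs : List A} →
                   All (λ x → q x ≡ r x) xs → filterᵇ q xs ≡ filterᵇ r xs
filterᵇ-cong-All [] = refl
filterᵇ-cong-All {q = q} {r} {x ∷ _} (q≡r ∷ qs≡rs) with q x | r x | q≡r
... | true  | true  | refl = cong (x ∷_) (filterᵇ-cong-All qs≡rs)
... | false | false | refl = filterᵇ-cong-All qs≡rs

filterᵇ-absorb : (q r : A → Bool) → (∀ x → r x ≡ false → q x ≡ false) →
                 filterᵇ q ∘ filterᵇ r ≗ filterᵇ q
filterᵇ-absorb q r r⇒q [] = refl
filterᵇ-absorb q r r⇒q (x ∷ xs) with r x in rx
... | false rewrite r⇒q x rx = filterᵇ-absorb q r r⇒q xs
... | true with q x
...   | true  = cong (x ∷_) (filterᵇ-absorb q r r⇒q xs)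
...   | false = filterᵇ-absorb q r r⇒q xs

concatMap-filterᵇ : (q : A → Bool) (g : A → List B) → (∀ x → q x ≡ false → g x ≡ []) →
                    concatMap g ∘ filterᵇ q ≗ concatMap g
concatMap-filterᵇ q g q⇒g [] = refl
concatMap-filterᵇ q g q⇒g (x ∷ xs) with q x in qx
... | true  = cong (g x ++_) (concatMap-filterᵇ q g q⇒g xs)
... | false rewrite q⇒g x qx = concatMap-filterᵇ q g q⇒g xs

any-++ : (q : A → Bool) (xs ys : List A) → any q (xs ++ ys) ≡ any q xs ∨ any q ys
any-++ q [] ys = refl
any-++ q (x ∷ xs) ys =
  trans (cong (q x ∨_) (any-++ q xs ys)) (sym (∨-assoc (q x) (any q xs) (any q ys)))

any-map : (q : B → Bool) (g : A → B) → any q ∘ map g ≗ any (q ∘ g)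
any-map q g xs = cong or (sym (map-∘ xs))

any-cong : {q r : A → Bool} → q ≗ r → any q ≗ any r
any-cong q≗r = cong or ∘ map-cong q≗r

any-none : (q : A → Bool) → (∀ x → q x ≡ false) → ∀ xs → any q xs ≡ false
any-none q q≡false [] = refl
any-none q q≡false (x ∷ xs) rewrite q≡false x = any-none q q≡false xs

module _ {_≟ᴬ_ : DecidableEquality A} {_≟ᴮ_ : DecidableEquality B}
         {g : A → B} (g-injective : Injective _≡_ _≡_ g) where

  deduplicate-map : deduplicate _≟ᴮ_ ∘ map g ≗ map g ∘ deduplicate _≟ᴬ_
  deduplicate-map [] = refl
  deduplicate-map (x ∷ xs) = cong (g x ∷_) (begin
    filter (¬? ∘ (g x ≟ᴮ_)) (deduplicate _≟ᴮ_ (map g xs))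
      ≡⟨ cong (filter (¬? ∘ (g x ≟ᴮ_))) (deduplicate-map xs) ⟩
    filter (¬? ∘ (g x ≟ᴮ_)) (map g ys)
      ≡⟨ filter-map (¬? ∘ (g x ≟ᴮ_)) g ys ⟩
    map g (filter (¬? ∘ (g x ≟ᴮ_) ∘ g) ys)
      ≡⟨ cong (map g) (filter-≐ (¬? ∘ (g x ≟ᴮ_) ∘ g) (¬? ∘ (x ≟ᴬ_)) distinct-images ys) ⟩
    map g (filter (¬? ∘ (x ≟ᴬ_)) ys) ∎)
    where
    open ≡-Reasoning
    ys = deduplicate _≟ᴬ_ xs
    distinct-images : (λ y → ¬ g x ≡ g y) ≐ (λ y → ¬ x ≡ y)
    distinct-images = (λ gx≢gy x≡y → gx≢gy (cong g x≡y))
                    , (λ x≢y gx≡gy → x≢y (g-injective gx≡gy))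

foldr-⊓-suc : ∀ r rs → foldr _⊓_ (suc r) (map suc rs) ≡ suc (foldr _⊓_ r rs)
foldr-⊓-suc r [] = refl
foldr-⊓-suc r (x ∷ rs) rewrite foldr-⊓-suc r rs = refl

foldr-⊓-zero : ∀ rs → foldr _⊓_ 0 rs ≡ 0
foldr-⊓-zero [] = refl
foldr-⊓-zero (x ∷ rs) rewrite foldr-⊓-zero rs = ⊓-zeroʳ x

lastEntry-map : (g : ℕ → ℕ) (x : ℕ) (xs : List ℕ) →
                lastEntry (map g (x ∷ xs)) ≡ g (lastEntry (x ∷ xs))
lastEntry-map g x [] = refl
lastEntry-map g x (y ∷ xs) = lastEntry-map g y xs

subseqs-map : (g : ℕ → ℕ) → subseqs ∘ map g ≗ map (map g) ∘ subseqs
subseqs-map g [] = refl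
subseqs-map g (x ∷ xs) rewrite subseqs-map g xs = begin
  map (g x ∷_) (map (map g) ss) ++ map (map g) ss
    ≡⟨ cong (_++ map (map g) ss) (trans (sym (map-∘ ss)) (map-∘ ss)) ⟩
  map (map g) (map (x ∷_) ss) ++ map (map g) ss
    ≡⟨ sym (map-++ (map g) (map (x ∷_) ss) ss) ⟩
  map (map g) (map (x ∷_) ss ++ ss) ∎
  where
  open ≡-Reasoning
  ss = subseqs xs

upTo-suc : ∀ n → upTo (suc n) ≡ 0 ∷ map suc (upTo n)
upTo-suc n = cong (0 ∷_) (sym (map-upTo suc n))

2≤ᵇ-+ʳ : ∀ m n → (2 ≤ᵇ m) ≡ true → (2 ≤ᵇ m + n) ≡ true
2≤ᵇ-+ʳ (2+ m) n _ = refl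

occ-++ : ∀ v xs ys → occ v (xs ++ ys) ≡ occ v xs + occ v ys
occ-++ v xs ys =
  trans (cong length (filter-++ (T? ∘ (v ≡ᵇ_)) xs ys)) (length-++ (filterᵇ (v ≡ᵇ_) xs))

occ-suc-map-suc : ∀ v y → occ (suc v) (map suc y) ≡ occ v y
occ-suc-map-suc v y =
  trans (cong length (filter-map (T? ∘ (suc v ≡ᵇ_)) suc y)) (length-map suc (filterᵇ (v ≡ᵇ_) y))

occ-zero-map-suc : ∀ y → occ 0 (map suc y) ≡ 0
occ-zero-map-suc [] = refl
occ-zero-map-suc (x ∷ y) = occ-zero-map-suc y

shift : List ℕ → List ℕ
shift y = 0 ∷ map suc y

extensions : ℕ → List ℕ → List (List ℕ)
extensions k e = map (λ v → e ++ [ v ]) (upTo k)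

zeroRepeatedᵇ : List ℕ → Bool
zeroRepeatedᵇ e = 2 ≤ᵇ occ 0 e

zeroUnrepeatedᵇ : List ℕ → Bool
zeroUnrepeatedᵇ = not ∘ zeroRepeatedᵇ

zeroRepeated-shift : ∀ y → zeroRepeatedᵇ (shift y) ≡ false
zeroRepeated-shift y = cong (λ c → 2 ≤ᵇ suc c) (occ-zero-map-suc y)

zeroRepeated-shift-∷ʳ-zero : ∀ y → zeroRepeatedᵇ (shift y ++ [ 0 ]) ≡ true
zeroRepeated-shift-∷ʳ-zero y rewrite occ-++ 0 (map suc y) [ 0 ] | occ-zero-map-suc y = refl

zeroRepeated-∷ʳ : ∀ e v → zeroRepeatedᵇ e ≡ true → zeroRepeatedᵇ (e ++ [ v ]) ≡ true
zeroRepeated-∷ʳ e v rep rewrite occ-++ 0 e [ v ] = 2≤ᵇ-+ʳ (occ 0 e) (occ 0 [ v ]) rep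

extensions-zeroRepeated : ∀ k e → zeroRepeatedᵇ e ≡ true →
                          filterᵇ zeroUnrepeatedᵇ (extensions k e) ≡ []
extensions-zeroRepeated k e rep =
  trans (filter-map (T? ∘ zeroUnrepeatedᵇ) (λ v → e ++ [ v ]) (upTo k))
        (cong (map (λ v → e ++ [ v ]))
              (filterᵇ-none _ (λ v → cong not (zeroRepeated-∷ʳ e v rep)) (upTo k)))

extensions-shift : ∀ k y →
                   filterᵇ zeroUnrepeatedᵇ (extensions (suc k) (shift y)) ≡ map shift (extensions k y)
extensions-shift k y = begin
  filterᵇ zeroUnrepeatedᵇ (extensions (suc k) (shift y))
    ≡⟨ cong (filterᵇ zeroUnrepeatedᵇ ∘ map extend) (upTo-suc k) ⟩
  filterᵇ zeroUnrepeatedᵇ (extend 0 ∷ map extend (map suc (upTo k)))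
    ≡⟨ filter-reject (T? ∘ zeroUnrepeatedᵇ) {extend 0}
                     (subst T (cong not (zeroRepeated-shift-∷ʳ-zero y))) ⟩
  filterᵇ zeroUnrepeatedᵇ (map extend (map suc (upTo k)))
    ≡⟨ cong (filterᵇ zeroUnrepeatedᵇ) (trans (sym (map-∘ (upTo k))) (map-cong shift-∷ʳ (upTo k))) ⟩
  filterᵇ zeroUnrepeatedᵇ (map (shift ∘ (λ v → y ++ [ v ])) (upTo k))
    ≡⟨ cong (filterᵇ zeroUnrepeatedᵇ) (map-∘ (upTo k)) ⟩
  filterᵇ zeroUnrepeatedᵇ (map shift (extensions k y))
    ≡⟨ filter-map (T? ∘ zeroUnrepeatedᵇ) shift (extensions k y) ⟩
  map shift (filterᵇ (zeroUnrepeatedᵇ ∘ shift) (extensions k y))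
    ≡⟨ cong (map shift)
            (filterᵇ-all (zeroUnrepeatedᵇ ∘ shift) (cong not ∘ zeroRepeated-shift) (extensions k y)) ⟩
  map shift (extensions k y) ∎
  where
  open ≡-Reasoning
  extend : ℕ → List ℕ
  extend v = shift y ++ [ v ]
  shift-∷ʳ : ∀ v → extend (suc v) ≡ shift (y ++ [ v ])
  shift-∷ʳ v = cong (0 ∷_) (sym (map-++ suc y [ v ]))

invSeqs-suc-shift : ∀ m → filterᵇ zeroUnrepeatedᵇ (invSeqs (suc m)) ≡ map shift (invSeqs m)
invSeqs-suc-shift zero = refl
invSeqs-suc-shift (suc m) = begin
  filterᵇ zeroUnrepeatedᵇ (concatMap (extensions (2+ m)) (invSeqs (suc m)))
    ≡⟨ filterᵇ-concatMap zeroUnrepeatedᵇ (extensions (2+ m)) (invSeqs (suc m)) ⟩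
  concatMap unrepeatedExtensions (invSeqs (suc m))
    ≡⟨ sym (concatMap-filterᵇ zeroUnrepeatedᵇ _ repeated⇒none (invSeqs (suc m))) ⟩
  concatMap unrepeatedExtensions (filterᵇ zeroUnrepeatedᵇ (invSeqs (suc m)))
    ≡⟨ cong (concatMap unrepeatedExtensions) (invSeqs-suc-shift m) ⟩
  concatMap unrepeatedExtensions (map shift (invSeqs m))
    ≡⟨ concatMap-map unrepeatedExtensions shift (invSeqs m) ⟩
  concatMap (unrepeatedExtensions ∘ shift) (invSeqs m)
    ≡⟨ concatMap-cong (extensions-shift (suc m)) (invSeqs m) ⟩
  concatMap (map shift ∘ extensions (suc m)) (invSeqs m)
    ≡⟨ sym (map-concatMap shift (extensions (suc m)) (invSeqs m)) ⟩
  map shift (invSeqs (suc m)) ∎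
  where
  open ≡-Reasoning
  unrepeatedExtensions : List ℕ → List (List ℕ)
  unrepeatedExtensions = filterᵇ zeroUnrepeatedᵇ ∘ extensions (2+ m)
  repeated⇒none : ∀ e → zeroUnrepeatedᵇ e ≡ false → unrepeatedExtensions e ≡ []
  repeated⇒none e unrepeated≡false =
    extensions-zeroRepeated (2+ m) e (not-injective unrepeated≡false)

invSeqs-length : ∀ m → All (λ e → length e ≡ m) (invSeqs m)
invSeqs-length zero = refl ∷ []
invSeqs-length (suc m) = concat⁺ (map⁺ (All.map extend (invSeqs-length m)))
  where
  extend : ∀ {e} → length e ≡ m → All (λ e′ → length e′ ≡ suc m) (extensions (suc m) e)
  extend {e} refl = map⁺ (applyUpTo⁺₂ id (suc m) λ v → trans (length-++ e) (+-comm (length e) 1))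

reduction-map-suc : ∀ s → reduction (map suc s) ≡ reduction s
reduction-map-suc s = trans (sym (map-∘ s)) (map-cong distinct-below s)
  where
  open ≡-Reasoning
  distinct-below : ∀ x → length (deduplicate _≟_ (filterᵇ (_<ᵇ suc x) (map suc s)))
                       ≡ length (deduplicate _≟_ (filterᵇ (_<ᵇ x) s))
  distinct-below x = begin
    length (deduplicate _≟_ (filterᵇ (_<ᵇ suc x) (map suc s)))
      ≡⟨ cong (length ∘ deduplicate _≟_) (filter-map (T? ∘ (_<ᵇ suc x)) suc s) ⟩
    length (deduplicate _≟_ (map suc (filterᵇ (_<ᵇ x) s)))
      ≡⟨ cong length (deduplicate-map suc-injective (filterᵇ (_<ᵇ x) s)) ⟩
    length (map suc (deduplicate _≟_ (filterᵇ (_<ᵇ x) s)))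
      ≡⟨ length-map suc (deduplicate _≟_ (filterᵇ (_<ᵇ x) s)) ⟩
    length (deduplicate _≟_ (filterᵇ (_<ᵇ x) s)) ∎

-- The second entry of the reduction counts the 0 below it, so it is not 0.
reduction-shift-≢-00 : ∀ q s → listEqᵇ (reduction (shift s)) (0 ∷ 0 ∷ q) ≡ false
reduction-shift-≢-00 q [] = refl
reduction-shift-≢-00 q (t ∷ s) = ∧-zeroʳ _

contains-00-shift : ∀ q y → containsᵇ (0 ∷ 0 ∷ q) (shift y) ≡ containsᵇ (0 ∷ 0 ∷ q) y
contains-00-shift q y = begin
  any occurs (map (0 ∷_) (subseqs (map suc y)) ++ subseqs (map suc y))
    ≡⟨ any-++ occurs (map (0 ∷_) (subseqs (map suc y))) (subseqs (map suc y)) ⟩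
  any occurs (map (0 ∷_) (subseqs (map suc y))) ∨ any occurs (subseqs (map suc y))
    ≡⟨ cong₂ _∨_ (cong (any occurs ∘ map (0 ∷_)) (subseqs-map suc y))
                 (cong (any occurs) (subseqs-map suc y)) ⟩
  any occurs (map (0 ∷_) (map (map suc) ss)) ∨ any occurs (map (map suc) ss)
    ≡⟨ cong₂ _∨_ (trans (cong (any occurs) (sym (map-∘ ss))) (any-map occurs shift ss))
                 (any-map occurs (map suc) ss) ⟩
  any (occurs ∘ shift) ss ∨ any (occurs ∘ map suc) ss
    ≡⟨ cong₂ _∨_ (any-none (occurs ∘ shift) (reduction-shift-≢-00 q) ss)
                 (any-cong (λ s → cong (λ r → listEqᵇ r (0 ∷ 0 ∷ q)) (reduction-map-suc s)) ss) ⟩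
  any occurs ss ∎
  where
  open ≡-Reasoning
  occurs : List ℕ → Bool
  occurs s = listEqᵇ (reduction s) (0 ∷ 0 ∷ q)
  ss = subseqs y

srpt-[] : ∀ m e → repeated m e ≡ [] → srpt m e ≡ m ∸ 1
srpt-[] m e eq with repeated m e
srpt-[] m e refl | .[] = refl

srpt-∷ : ∀ m e {r rs} → repeated m e ≡ r ∷ rs → srpt m e ≡ foldr _⊓_ r rs
srpt-∷ m e eq with repeated m e
srpt-∷ m e refl | .(_ ∷ _) = refl

repeated-shift : ∀ n y → repeated (suc n) (shift y) ≡ map suc (repeated n y)
repeated-shift n y = begin
  filterᵇ twice (upTo (suc n))
    ≡⟨ cong (filterᵇ twice) (upTo-suc n) ⟩
  filterᵇ twice (0 ∷ map suc (upTo n))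
    ≡⟨ filter-reject (T? ∘ twice) {0} {map suc (upTo n)} (subst T (zeroRepeated-shift y)) ⟩
  filterᵇ twice (map suc (upTo n))
    ≡⟨ filter-map (T? ∘ twice) suc (upTo n) ⟩
  map suc (filterᵇ (twice ∘ suc) (upTo n))
    ≡⟨ cong (map suc)
            (filterᵇ-cong-All (All.universal (λ v → cong (2 ≤ᵇ_) (occ-suc-map-suc v y)) (upTo n))) ⟩
  map suc (repeated n y) ∎
  where
  open ≡-Reasoning
  twice : ℕ → Bool
  twice v = 2 ≤ᵇ occ v (shift y)

srpt-shift : ∀ n y → 1 ≤ n → srpt (suc n) (shift y) ≡ suc (srpt n y)
srpt-shift (suc n) y _ with repeated (suc n) y in eq
... | [] = srpt-[] (2+ n) (shift y) (trans (repeated-shift (suc n) y) (cong (map suc) eq))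
... | r ∷ rs = trans (srpt-∷ (2+ n) (shift y) (trans (repeated-shift (suc n) y) (cong (map suc) eq)))
                     (foldr-⊓-suc r rs)

srpt-zeroRepeated : ∀ n e → zeroRepeatedᵇ e ≡ true → srpt (suc n) e ≡ 0
srpt-zeroRepeated n e rep =
  trans (srpt-∷ (suc n) e (filter-accept (T? ∘ λ v → 2 ≤ᵇ occ v e) (subst T (sym rep) tt)))
        (foldr-⊓-zero (filterᵇ (λ v → 2 ≤ᵇ occ v e) (applyUpTo suc n)))

counted : ℕ → ℕ → ℕ → List ℕ → Bool
counted m k ℓ e = avoidsᵇ pat0012 e ∧ (srpt m e ≡ᵇ k) ∧ (lastEntry e ≡ᵇ ℓ)

counted-zeroRepeated : ∀ n k ℓ e → zeroRepeatedᵇ e ≡ true → counted (suc n) (suc k) ℓ e ≡ false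
counted-zeroRepeated n k ℓ e rep rewrite srpt-zeroRepeated n e rep =
  ∧-zeroʳ (avoidsᵇ pat0012 e)

counted-shift : ∀ n k ℓ a ys → 1 ≤ n →
                counted (suc n) (suc k) (suc ℓ) (shift (a ∷ ys)) ≡ counted n k ℓ (a ∷ ys)
counted-shift n k ℓ a ys 1≤n
  rewrite contains-00-shift (1 ∷ 2 ∷ []) (a ∷ ys) | srpt-shift n (a ∷ ys) 1≤n | lastEntry-map suc a ys
  = refl

f-suc : ∀ n k ℓ → 1 ≤ n → f (suc n) (suc k) (suc ℓ) ≡ f n k ℓ
f-suc (suc n) k ℓ 1≤n = begin
  length (filterᵇ counted′ (invSeqs (2+ n)))
    ≡⟨ cong length
            (sym (filterᵇ-absorb counted′ zeroUnrepeatedᵇ repeated⇒uncounted (invSeqs (2+ n)))) ⟩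
  length (filterᵇ counted′ (filterᵇ zeroUnrepeatedᵇ (invSeqs (2+ n))))
    ≡⟨ cong (length ∘ filterᵇ counted′) (invSeqs-suc-shift (suc n)) ⟩
  length (filterᵇ counted′ (map shift (invSeqs (suc n))))
    ≡⟨ cong length (filter-map (T? ∘ counted′) shift (invSeqs (suc n))) ⟩
  length (map shift (filterᵇ (counted′ ∘ shift) (invSeqs (suc n))))
    ≡⟨ length-map shift (filterᵇ (counted′ ∘ shift) (invSeqs (suc n))) ⟩
  length (filterᵇ (counted′ ∘ shift) (invSeqs (suc n)))
    ≡⟨ cong length (filterᵇ-cong-All {q = counted′ ∘ shift}
                                     (All.map (λ {y} → shifted {y}) (invSeqs-length (suc n)))) ⟩
  length (filterᵇ (counted (suc n) k ℓ) (invSeqs (suc n))) ∎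
  where
  open ≡-Reasoning
  counted′ = counted (2+ n) (suc k) (suc ℓ)
  repeated⇒uncounted : ∀ e → zeroUnrepeatedᵇ e ≡ false → counted′ e ≡ false
  repeated⇒uncounted e unrepeated≡false =
    counted-zeroRepeated (suc n) k (suc ℓ) e (not-injective unrepeated≡false)
  -- The length invariant excludes y = [], where lastEntry takes the junk value 0.
  shifted : ∀ {y} → length y ≡ suc n → counted′ (shift y) ≡ counted (suc n) k ℓ y
  shifted {[]} ()
  shifted {a ∷ ys} _ = counted-shift (suc n) k ℓ a ys 1≤n

lemma3p3 : (n k : ℕ) → 2 ≤ n → k ≤ n ∸ 2 → f n k k ≡ f (n ∸ k) 0 0
lemma3p3 n zero _ _ = refl
lemma3p3 (suc (suc (suc n))) (suc k) _ (s≤s k≤n) =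
  trans (f-suc (2+ n) k k (s≤s z≤n)) (lemma3p3 (2+ n) k (s≤s (s≤s z≤n)) k≤n)
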